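{- Let $n=2^k$ with $k\geq1$ an integer, and let $\omega_n=e^{2\pi i/n}$. Define $$A_{n}=\{\Re(\omega_n^t):0\leq t<2^{k-2}\},\qquad B_{n}=\{i\Im(\omega_n^t):0<t\leq2^{k-2}\},$$ where $t$ ranges over integers. Then $A_n\cup B_n$ is a basis of $\mathbb{Q}(\omega_n)$ over $\mathbb{Q}$. Moreover, for any integer $t$, all coordinates of the vectors $\Re(\omega_n^t)$ and $i\Im(\omega_n^t)$ with respect to this basis lie in the set $\{ -1,0,1\}$.
   Context: $\Re$ and $\Im$ denote real and imaginary parts; $\mathbb{Q}(\omega_n)$ is the $n$-th cyclotomic field, viewed as a $\mathbb{Q}$-vector space. -}

module Defs where

open import Data.Nat as ℕ using (ℕ; zero; suc; _∸_; _^_)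
open import Data.Integer as ℤ using (ℤ; +_; -[1+_])
open import Data.Rational using (ℚ; 0ℚ; 1ℚ; ½; _+_; _-_; _*_; -_)
open import Data.Fin using (Fin; zero; suc; fromℕ; inject₁)
open import Data.List using (List; []; _∷_; map; _++_; filter; upTo; length)
open import Data.List.Relation.Unary.All using (All)
open import Data.Product using (_×_; Σ)
open import Data.Sum using (_⊎_)
open import Relation.Nullary.Decidable using (_×-dec_)
open import Relation.Binary.PropositionalEquality using (_≡_)
open import Function using (_∘_)

-- Model of Q(ω_n), n = 2^k, k ≥ 1:  Q(ω_n) ≅ Q[x]/(x^m + 1) with
-- m = 2^(k-1) (Φ_{2^k}(x) = x^(2^(k-1)) + 1) and ω_n ↦ x.
-- An element is its coordinate vector w.r.t. 1, x, …, x^(m-1).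

deg : ℕ → ℕ
deg k = 2 ^ (k ∸ 1)

Elem : ℕ → Set
Elem m = Fin m → ℚ

_≈_ : ∀ {m} → Elem m → Elem m → Set
u ≈ v = ∀ i → u i ≡ v i

zeroE : ∀ {m} → Elem m
zeroE _ = 0ℚ

_+E_ : ∀ {m} → Elem m → Elem m → Elem m
(u +E v) i = u i + v i

_-E_ : ∀ {m} → Elem m → Elem m → Elem m
(u -E v) i = u i - v i

_·E_ : ∀ {m} → ℚ → Elem m → Elem m
(c ·E v) i = c * v i

oneE : ∀ {m} → Elem m
oneE zero = 1ℚ
oneE (suc _) = 0ℚ

-- multiplication by ω = x, using x^m = -1
mulω : ∀ {m} → Elem m → Elem m
mulω {zero} v = v
mulω {suc j} v zero = - v (fromℕ j)
mulω {suc j} v (suc i) = v (inject₁ i)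

powℕ : (m : ℕ) → ℕ → Elem m
powℕ m zero = oneE
powℕ m (suc t) = mulω (powℕ m t)

-- ω^t for t ∈ ℤ; ω^(-1) = ω^(2m-1) since ω^(2m) = ω^n = 1
ωpow : (m : ℕ) → ℤ → Elem m
ωpow m (+ t) = powℕ m t
ωpow m -[1+ t ] = powℕ m ((2 ℕ.* m ∸ 1) ℕ.* suc t)

-- complex conjugation maps ω^t to ω^(-t), hence
-- Re(ω^t) = (ω^t + ω^(-t))/2 and i·Im(ω^t) = (ω^t - ω^(-t))/2
Reω : (k : ℕ) → ℤ → Elem (deg k)
Reω k t = ½ ·E (ωpow (deg k) t +E ωpow (deg k) (ℤ.- t))

iImω : (k : ℕ) → ℤ → Elem (deg k)
iImω k t = ½ ·E (ωpow (deg k) t -E ωpow (deg k) (ℤ.- t))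

-- index sets: A uses 0 ≤ t < 2^(k-2), i.e. 4t < 2^k;
-- B uses 0 < t ≤ 2^(k-2), i.e. 1 ≤ t and 4t ≤ 2^k
indicesA : ℕ → List ℕ
indicesA k = filter (λ t → 4 ℕ.* t ℕ.<? 2 ^ k) (upTo (2 ^ k))

indicesB : ℕ → List ℕ
indicesB k = filter (λ t → (1 ℕ.≤? t) ×-dec (4 ℕ.* t ℕ.≤? 2 ^ k)) (upTo (suc (2 ^ k)))

A : (k : ℕ) → List (Elem (deg k))
A k = map (Reω k ∘ +_) (indicesA k)

B : (k : ℕ) → List (Elem (deg k))
B k = map (iImω k ∘ +_) (indicesB k)

AB : (k : ℕ) → List (Elem (deg k))
AB k = A k ++ B k

lincomb : ∀ {m} → List (Elem m) → List ℚ → Elem m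
lincomb [] _ = zeroE
lincomb (b ∷ bs) [] = zeroE
lincomb (b ∷ bs) (c ∷ cs) = (c ·E b) +E lincomb bs cs

LinIndep : ∀ {m} → List (Elem m) → Set
LinIndep bs = (cs : List ℚ) → length cs ≡ length bs →
  lincomb bs cs ≈ zeroE → All (_≡ 0ℚ) cs

Spans : ∀ {m} → List (Elem m) → Set
Spans {m} bs = (v : Elem m) →
  Σ (List ℚ) λ cs → length cs ≡ length bs × lincomb bs cs ≈ v

IsBasis : ∀ {m} → List (Elem m) → Set
IsBasis bs = LinIndep bs × Spans bs

InMinusOneZeroOne : ℚ → Set
InMinusOneZeroOne c = c ≡ - 1ℚ ⊎ c ≡ 0ℚ ⊎ c ≡ 1ℚ

-- v has coordinates (w.r.t. bs) all in {-1,0,1}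
-- (coordinates are unique once bs is a basis)
TernaryCoords : ∀ {m} → List (Elem m) → Elem m → Set
TernaryCoords bs v = Σ (List ℚ) λ cs →
  length cs ≡ length bs × All InMinusOneZeroOne cs × lincomb bs cs ≈ v

{-# OPTIONS --safe #-}
module Submission where

-- In Q[x]/(x^m + 1), m = 2^(k-1), multiplication by ω = x is a signed cyclic shift, so every power
-- ω^t is a signed unit vector ±e_j, and its conjugate ω^(-t) is ±e_0 if j = 0 and ∓e_(m-j) otherwise.
-- Hence Re ω^t and i Im ω^t are ±e_0, 0, or ±½(e_j ∓ e_(m-j)). Up to sign, the symmetry j ↦ m - j
-- brings each of these to a member of A ∪ B (with i Im ω^h = e_h for h = m/2), or to 0. Finally
-- A ∪ B is a basis because the standard basis is recovered explicitly: e_0 = Re ω^0,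
-- e_h = i Im ω^h, and e_j = Re ω^j + i Im ω^j, e_(m-j) = i Im ω^j - Re ω^j for 0 < j < h.

open import Defs
open import Data.Product using (_×_; _,_; proj₂)
open import Data.Nat as ℕ using (ℕ; _≤_; zero; suc; _∸_; _^_; z≤n; s≤s; z<s; s<s; _<_)
open import Data.Nat.Properties as ℕP using ()
open import Data.Nat.GeneralisedArithmetic using (fold; fold-+)
open import Data.Integer as ℤ using (ℤ; +_; -[1+_])
open import Data.Rational using (ℚ; 0ℚ; 1ℚ; ½; _+_; _-_; _*_; -_)
open import Data.Rational.Properties as ℚP using ()
open import Data.Rational.Solver using (module +-*-Solver)
open import Data.Bool using (Bool; true; false; not; if_then_else_)
open import Data.Bool.Properties using (not-involutive)
open import Data.Fin using (Fin; zero; suc; fromℕ; inject₁; toℕ; fromℕ<)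
open import Data.Fin.Properties as FinP using ()
open import Data.Sum using (_⊎_; inj₁; inj₂)
open import Data.List using (List; []; _∷_; map; _++_; applyUpTo; length; filter; upTo)
open import Data.List.Properties as ListP using ()
open import Data.List.Relation.Unary.All as All using (All; []; _∷_)
open import Data.List.Relation.Unary.All.Properties as AllP using ()
open import Relation.Nullary using (¬_; yes; no; does; contradiction)
open import Relation.Nullary.Decidable using (_×-dec_; dec-true; dec-false)
open import Relation.Binary.PropositionalEquality
open import Relation.Binary.Definitions using (tri<; tri≈; tri>)
open import Relation.Unary using (Pred; Decidable)
open import Function using (_∘_)
open import Level using (0ℓ)
open +-*-Solver

δ : ℕ → ℕ → ℚ
δ a b = if does (a ℕ.≟ b) then 1ℚ else 0ℚ

δ-≡ : ∀ a b → a ≡ b → δ a b ≡ 1ℚ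
δ-≡ a b a≡b rewrite dec-true (a ℕ.≟ b) a≡b = refl

δ-≢ : ∀ a b → a ≢ b → δ a b ≡ 0ℚ
δ-≢ a b a≢b rewrite dec-false (a ℕ.≟ b) a≢b = refl

sign : Bool → ℚ
sign false = 1ℚ
sign true = - 1ℚ

sign-not : ∀ s → sign (not s) ≡ - sign s
sign-not false = refl
sign-not true = refl

½[x+x]≡x : ∀ x → ½ * (x + x) ≡ x
½[x+x]≡x x = trans (solve 2 (λ h x → h :* (x :+ x) := (h :+ h) :* x) refl ½ x) (ℚP.*-identityˡ x)

-- Powers of ω as signed unit vectors

SignedIndex : Set
SignedIndex = Bool × ℕ

unit : ∀ {m} → SignedIndex → Elem m
unit (s , j) i = sign s * δ (toℕ i) j

InRange : ℕ → SignedIndex → Set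
InRange m (_ , j) = j < m

rotate : ℕ → SignedIndex → SignedIndex
rotate m (s , j) = if does (suc j ℕ.≟ m) then (not s , 0) else (s , suc j)

rotate-wrap : ∀ m s j → suc j ≡ m → rotate m (s , j) ≡ (not s , 0)
rotate-wrap m s j e rewrite dec-true (suc j ℕ.≟ m) e = refl

rotate-shift : ∀ m s j → suc j ≢ m → rotate m (s , j) ≡ (s , suc j)
rotate-shift m s j e rewrite dec-false (suc j ℕ.≟ m) e = refl

rotate-inRange : ∀ m p → InRange m p → InRange m (rotate m p)
rotate-inRange m (s , j) j<m with suc j ℕ.≟ m
... | yes e rewrite rotate-wrap m s j e = ℕP.<-≤-trans z<s j<m
... | no ne rewrite rotate-shift m s j ne = ℕP.≤∧≢⇒< j<m ne

mulω-cong : ∀ {m} {u v : Elem m} → u ≈ v → mulω u ≈ mulω v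
mulω-cong {zero} e ()
mulω-cong {suc m} e zero = cong -_ (e (fromℕ m))
mulω-cong {suc m} e (suc i) = e (inject₁ i)

mulω-unit : ∀ m p → mulω {m} (unit p) ≈ unit (rotate m p)
mulω-unit zero p ()
mulω-unit (suc m) (s , j) i with m ℕ.≟ j
... | yes refl rewrite rotate-wrap (suc m) s j refl = wrapped i
  where
  wrapped : ∀ i → mulω {suc m} (unit (s , m)) i ≡ unit {suc m} (not s , 0) i
  wrapped zero rewrite FinP.toℕ-fromℕ m | δ-≡ m m refl | sign-not s =
    solve 1 (λ x → :- (x :* con 1ℚ) := :- x :* con 1ℚ) refl (sign s)
  wrapped (suc i) rewrite FinP.toℕ-inject₁ i
    | δ-≢ (toℕ i) m (λ e → ℕP.<-irrefl e (FinP.toℕ<n i)) =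
    trans (ℚP.*-zeroʳ (sign s)) (sym (ℚP.*-zeroʳ (sign (not s))))
... | no m≢j rewrite rotate-shift (suc m) s j (m≢j ∘ sym ∘ ℕP.suc-injective) = shifted i
  where
  shifted : ∀ i → mulω {suc m} (unit (s , j)) i ≡ unit {suc m} (s , suc j) i
  shifted zero rewrite FinP.toℕ-fromℕ m | δ-≢ m j m≢j | ℚP.*-zeroʳ (sign s) = refl
  shifted (suc i) rewrite FinP.toℕ-inject₁ i = refl

powIndex : ℕ → ℕ → SignedIndex
powIndex m = fold (false , 0) (rotate m)

powℕ≈unit : ∀ m u → powℕ m u ≈ unit (powIndex m u)
powℕ≈unit m zero zero = refl
powℕ≈unit m zero (suc i) = refl
powℕ≈unit m (suc u) i = trans (mulω-cong (powℕ≈unit m u) i) (mulω-unit m (powIndex m u) i)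

powIndex-inRange : ∀ m u → 0 < m → InRange m (powIndex m u)
powIndex-inRange m zero 0<m = 0<m
powIndex-inRange m (suc u) 0<m = rotate-inRange m (powIndex m u) (powIndex-inRange m u 0<m)

rotate^-shift : ∀ m s j a → j ℕ.+ a < m → fold (s , j) (rotate m) a ≡ (s , j ℕ.+ a)
rotate^-shift m s j zero _ = cong (s ,_) (sym (ℕP.+-identityʳ j))
rotate^-shift m s j (suc a) j+1+a<m = begin
    rotate m (fold (s , j) (rotate m) a)
  ≡⟨ cong (rotate m) (rotate^-shift m s j a (ℕP.<-trans (ℕP.n<1+n _) 1+j+a<m)) ⟩
    rotate m (s , j ℕ.+ a)
  ≡⟨ rotate-shift m s (j ℕ.+ a) (λ e → ℕP.<-irrefl e 1+j+a<m) ⟩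
    (s , suc (j ℕ.+ a))
  ≡⟨ cong (s ,_) (sym (ℕP.+-suc j a)) ⟩
    (s , j ℕ.+ suc a)
  ∎
  where
  open ≡-Reasoning
  1+j+a<m : suc (j ℕ.+ a) < m
  1+j+a<m = subst (_< m) (ℕP.+-suc j a) j+1+a<m

powIndex-< : ∀ m t → t < m → powIndex m t ≡ (false , t)
powIndex-< m t t<m = rotate^-shift m false 0 t t<m

rotate^m-negates : ∀ m s j → j < m → fold (s , j) (rotate m) m ≡ (not s , j)
rotate^m-negates m s j j<m = begin
    fold (s , j) (rotate m) m
  ≡⟨ cong (fold (s , j) (rotate m)) (sym j+[1+d]≡m) ⟩
    fold (s , j) (rotate m) (j ℕ.+ suc d)
  ≡⟨ fold-+ (s , j) (rotate m) j ⟩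
    fold (rotate m (fold (s , j) (rotate m) d)) (rotate m) j
  ≡⟨ cong (λ p → fold (rotate m p) (rotate m) j) (rotate^-shift m s j d j+d<m) ⟩
    fold (rotate m (s , j ℕ.+ d)) (rotate m) j
  ≡⟨ cong (λ p → fold p (rotate m) j) (rotate-wrap m s (j ℕ.+ d) 1+j+d≡m) ⟩
    fold (not s , 0) (rotate m) j
  ≡⟨ rotate^-shift m (not s) 0 j j<m ⟩
    (not s , j)
  ∎
  where
  open ≡-Reasoning
  d = m ∸ suc j
  1+j+d≡m : suc (j ℕ.+ d) ≡ m
  1+j+d≡m = ℕP.m+[n∸m]≡n j<m
  j+[1+d]≡m : j ℕ.+ suc d ≡ m
  j+[1+d]≡m = trans (ℕP.+-suc j d) 1+j+d≡m
  j+d<m : j ℕ.+ d < m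
  j+d<m = subst (j ℕ.+ d <_) 1+j+d≡m (ℕP.n<1+n _)

rotate^2m-id : ∀ m p → InRange m p → fold p (rotate m) (m ℕ.+ m) ≡ p
rotate^2m-id m (s , j) j<m = begin
    fold (s , j) (rotate m) (m ℕ.+ m)
  ≡⟨ fold-+ (s , j) (rotate m) m ⟩
    fold (fold (s , j) (rotate m) m) (rotate m) m
  ≡⟨ cong (λ p → fold p (rotate m) m) (rotate^m-negates m s j j<m) ⟩
    fold (not s , j) (rotate m) m
  ≡⟨ rotate^m-negates m (not s) j j<m ⟩
    (not (not s) , j)
  ≡⟨ cong (_, j) (not-involutive s) ⟩
    (s , j)
  ∎
  where open ≡-Reasoning

-- The index of the conjugate: ω^(-j) = -ω^(m-j) for 0 < j < m.
mirror : ℕ → SignedIndex → SignedIndex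
mirror m (s , zero) = (s , zero)
mirror m (s , suc j) = (not s , m ∸ suc j)

1+[m∸1+j]≡m∸j : ∀ m j → j < m → suc (m ∸ suc j) ≡ m ∸ j
1+[m∸1+j]≡m∸j (suc m) zero _ = refl
1+[m∸1+j]≡m∸j (suc m) (suc j) (s≤s j<m) = 1+[m∸1+j]≡m∸j m j j<m

m∸1+j<m : ∀ m j → 0 < m → m ∸ suc j < m
m∸1+j<m (suc m) j _ = s≤s (ℕP.m∸n≤m m j)

mirror-inRange : ∀ m p → InRange m p → InRange m (mirror m p)
mirror-inRange m (s , zero) 0<m = 0<m
mirror-inRange m (s , suc j) 1+j<m = m∸1+j<m m j (ℕP.<-trans z<s 1+j<m)

rotate∘mirror∘rotate : ∀ m p → InRange m p → rotate m (mirror m (rotate m p)) ≡ mirror m p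
rotate∘mirror∘rotate m (s , j) j<m with suc j ℕ.≟ m
rotate∘mirror∘rotate m (s , zero) _ | yes 1≡m
  rewrite rotate-wrap m s zero 1≡m | rotate-wrap m (not s) zero 1≡m = cong (_, 0) (not-involutive s)
rotate∘mirror∘rotate m (s , suc j) _ | yes 2+j≡m
  rewrite rotate-wrap m s (suc j) 2+j≡m | sym 2+j≡m
  | rotate-shift (suc (suc j)) (not s) 0 (λ 1≡2+j → ℕP.1+n≢0 (ℕP.suc-injective (sym 1≡2+j)))
  = cong (not s ,_) (sym (ℕP.m+n∸n≡m 1 j))
... | no 1+j≢m rewrite rotate-shift m s j 1+j≢m with j
...   | zero rewrite rotate-wrap m (not s) (m ∸ 1) (1+[m∸1+j]≡m∸j m 0 j<m) =
        cong (_, 0) (not-involutive s)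
...   | suc j' rewrite rotate-shift m (not s) (m ∸ suc (suc j'))
          (λ e → ℕP.<-irrefl (trans (sym (1+[m∸1+j]≡m∸j m (suc j') j<m)) e)
                             (m∸1+j<m m j' (ℕP.<-trans z<s j<m)))
        = cong (not s ,_) (1+[m∸1+j]≡m∸j m (suc j') j<m)

-- rotate has order 2m, so rotating 2m - 1 times inverts it.
rotate^[2m-1]∘mirror : ∀ m p → InRange (suc m) p →
  fold (mirror (suc m) p) (rotate (suc m)) (2 ℕ.* suc m ∸ 1) ≡ mirror (suc m) (rotate (suc m) p)
rotate^[2m-1]∘mirror m p p<m = begin
    fold (mirror M p) (rotate M) n
  ≡⟨ cong (λ p → fold p (rotate M) n) (sym (rotate∘mirror∘rotate M p p<m)) ⟩
    fold (rotate M q) (rotate M) n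
  ≡⟨ sym (fold-+ q (rotate M) n) ⟩
    fold q (rotate M) (n ℕ.+ 1)
  ≡⟨ cong (fold q (rotate M)) (trans (ℕP.+-comm n 1) (cong (M ℕ.+_) (ℕP.+-identityʳ M))) ⟩
    fold q (rotate M) (M ℕ.+ M)
  ≡⟨ rotate^2m-id M q (mirror-inRange M (rotate M p) (rotate-inRange M p p<m)) ⟩
    q
  ∎
  where
  open ≡-Reasoning
  M = suc m
  n = 2 ℕ.* M ∸ 1
  q = mirror M (rotate M p)

powIndex-[2m-1]* : ∀ m u →
  fold (false , 0) (rotate (suc m)) ((2 ℕ.* suc m ∸ 1) ℕ.* u) ≡ mirror (suc m) (powIndex (suc m) u)
powIndex-[2m-1]* m zero = cong (fold (false , 0) (rotate (suc m))) (ℕP.*-zeroʳ (2 ℕ.* suc m ∸ 1))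
powIndex-[2m-1]* m (suc u) = begin
    fold p₀ (rotate M) (n ℕ.* suc u)
  ≡⟨ cong (fold p₀ (rotate M)) (ℕP.*-suc n u) ⟩
    fold p₀ (rotate M) (n ℕ.+ n ℕ.* u)
  ≡⟨ fold-+ p₀ (rotate M) n ⟩
    fold (fold p₀ (rotate M) (n ℕ.* u)) (rotate M) n
  ≡⟨ cong (λ p → fold p (rotate M) n) (powIndex-[2m-1]* m u) ⟩
    fold (mirror M (powIndex M u)) (rotate M) n
  ≡⟨ rotate^[2m-1]∘mirror m (powIndex M u) (powIndex-inRange M u z<s) ⟩
    mirror M (powIndex M (suc u))
  ∎
  where
  open ≡-Reasoning
  M = suc m
  n = 2 ℕ.* M ∸ 1
  p₀ = (false , 0)

ωpow-neg≈unit : ∀ m u → ωpow (suc m) (ℤ.- (+ u)) ≈ unit (mirror (suc m) (powIndex (suc m) u))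
ωpow-neg≈unit m zero = powℕ≈unit (suc m) 0
ωpow-neg≈unit m (suc u) i =
  trans (powℕ≈unit (suc m) ((2 ℕ.* suc m ∸ 1) ℕ.* suc u) i)
        (cong (λ p → unit p i) (powIndex-[2m-1]* m (suc u)))

-- Real and imaginary parts

reω : (m : ℕ) → ℤ → Elem m
reω m t = ½ ·E (ωpow m t +E ωpow m (ℤ.- t))

imω : (m : ℕ) → ℤ → Elem m
imω m t = ½ ·E (ωpow m t -E ωpow m (ℤ.- t))

reUnit : (m : ℕ) → SignedIndex → Elem m
reUnit m p i = ½ * (unit p i + unit (mirror m p) i)

imUnit : (m : ℕ) → SignedIndex → Elem m
imUnit m p i = ½ * (unit p i - unit (mirror m p) i)

negE : ∀ {m} → Elem m → Elem m
negE v i = - v i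

reω-+ : ∀ m u → reω (suc m) (+ u) ≈ reUnit (suc m) (powIndex (suc m) u)
reω-+ m u i = cong (½ *_) (cong₂ _+_ (powℕ≈unit (suc m) u i) (ωpow-neg≈unit m u i))

imω-+ : ∀ m u → imω (suc m) (+ u) ≈ imUnit (suc m) (powIndex (suc m) u)
imω-+ m u i = cong (½ *_) (cong₂ _-_ (powℕ≈unit (suc m) u i) (ωpow-neg≈unit m u i))

reω-− : ∀ m u → reω (suc m) -[1+ u ] ≈ reUnit (suc m) (powIndex (suc m) (suc u))
reω-− m u i = cong (½ *_) (trans (cong₂ _+_ (ωpow-neg≈unit m (suc u) i) (powℕ≈unit (suc m) (suc u) i))
                                 (ℚP.+-comm (unit (mirror M p) i) (unit p i)))
  where
  M = suc m
  p = powIndex M (suc u)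

imω-− : ∀ m u → imω (suc m) -[1+ u ] ≈ negE (imUnit (suc m) (powIndex (suc m) (suc u)))
imω-− m u i =
  trans (cong (½ *_) (cong₂ _-_ (ωpow-neg≈unit m (suc u) i) (powℕ≈unit (suc m) (suc u) i)))
        (solve 3 (λ h a b → h :* (a :- b) := :- (h :* (b :- a))) refl ½ (unit (mirror M p) i) (unit p i))
  where
  M = suc m
  p = powIndex M (suc u)

reCoord : ℕ → ℕ → ℕ → ℚ
reCoord m j n = ½ * (δ n j - δ n (m ∸ j))

imCoord : ℕ → ℕ → ℕ → ℚ
imCoord m j n = ½ * (δ n j + δ n (m ∸ j))

reUnit-zero : ∀ m s (i : Fin m) → reUnit m (s , 0) i ≡ sign s * δ (toℕ i) 0
reUnit-zero m s i = ½[x+x]≡x (sign s * δ (toℕ i) 0)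

imUnit-zero : ∀ m s (i : Fin m) → imUnit m (s , 0) i ≡ 0ℚ
imUnit-zero m s i = trans (cong (½ *_) (ℚP.+-inverseʳ (sign s * δ (toℕ i) 0))) (ℚP.*-zeroʳ ½)

reUnit-suc : ∀ m s j (i : Fin m) → reUnit m (s , suc j) i ≡ sign s * reCoord m (suc j) (toℕ i)
reUnit-suc m s j i rewrite sign-not s =
  solve 4 (λ h σ a b → h :* (σ :* a :+ (:- σ) :* b) := σ :* (h :* (a :- b)))
    refl ½ (sign s) (δ (toℕ i) (suc j)) (δ (toℕ i) (m ∸ suc j))

imUnit-suc : ∀ m s j (i : Fin m) → imUnit m (s , suc j) i ≡ sign s * imCoord m (suc j) (toℕ i)
imUnit-suc m s j i rewrite sign-not s =
  solve 4 (λ h σ a b → h :* (σ :* a :- (:- σ) :* b) := σ :* (h :* (a :+ b)))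
    refl ½ (sign s) (δ (toℕ i) (suc j)) (δ (toℕ i) (m ∸ suc j))

reCoord-mirror : ∀ m j n → j ≤ m → reCoord m j n ≡ - reCoord m (m ∸ j) n
reCoord-mirror m j n j≤m rewrite ℕP.m∸[m∸n]≡n j≤m =
  solve 3 (λ h a b → h :* (a :- b) := :- (h :* (b :- a))) refl ½ (δ n j) (δ n (m ∸ j))

imCoord-mirror : ∀ m j n → j ≤ m → imCoord m j n ≡ imCoord m (m ∸ j) n
imCoord-mirror m j n j≤m rewrite ℕP.m∸[m∸n]≡n j≤m =
  cong (½ *_) (ℚP.+-comm (δ n j) (δ n (m ∸ j)))

reCoord-half : ∀ h n → reCoord (h ℕ.+ h) h n ≡ 0ℚ
reCoord-half h n rewrite ℕP.m+n∸n≡m h h =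
  trans (cong (½ *_) (ℚP.+-inverseʳ (δ n h))) (ℚP.*-zeroʳ ½)

-- Ternary coordinates

nth : ∀ {m} → List (Elem m) → ℕ → Elem m
nth [] _ = zeroE
nth (x ∷ xs) zero = x
nth (x ∷ xs) (suc p) = nth xs p

lincomb-zeros : ∀ {m} (xs : List (Elem m)) n → lincomb xs (applyUpTo (λ _ → 0ℚ) n) ≈ zeroE
lincomb-zeros [] n i = refl
lincomb-zeros (x ∷ xs) zero i = refl
lincomb-zeros (x ∷ xs) (suc n) i rewrite lincomb-zeros xs n i | ℚP.*-zeroˡ (x i) = refl

lincomb-δ : ∀ {m} (xs : List (Elem m)) p → p < length xs →
  lincomb xs (applyUpTo (λ t → δ t p) (length xs)) ≈ nth xs p
lincomb-δ (x ∷ xs) zero _ i rewrite lincomb-zeros xs (length xs) i | ℚP.*-identityˡ (x i) =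
  ℚP.+-identityʳ (x i)
lincomb-δ (x ∷ xs) (suc p) (s≤s p<n) i rewrite lincomb-δ xs p p<n i | ℚP.*-zeroˡ (x i) =
  ℚP.+-identityˡ (nth xs p i)

lincomb-neg : ∀ {m} (xs : List (Elem m)) cs → lincomb xs (map -_ cs) ≈ negE (lincomb xs cs)
lincomb-neg [] cs i = refl
lincomb-neg (x ∷ xs) [] i = refl
lincomb-neg (x ∷ xs) (c ∷ cs) i rewrite lincomb-neg xs cs i =
  solve 3 (λ c x l → (:- c) :* x :+ (:- l) := :- (c :* x :+ l)) refl c (x i) (lincomb xs cs i)

δ-ternary : ∀ a b → InMinusOneZeroOne (δ a b)
δ-ternary a b with does (a ℕ.≟ b)
... | true = inj₂ (inj₂ refl)
... | false = inj₂ (inj₁ refl)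

neg-ternary : ∀ {c} → InMinusOneZeroOne c → InMinusOneZeroOne (- c)
neg-ternary (inj₁ refl) = inj₂ (inj₂ refl)
neg-ternary (inj₂ (inj₁ refl)) = inj₂ (inj₁ refl)
neg-ternary (inj₂ (inj₂ refl)) = inj₁ refl

module _ {m} (bs : List (Elem m)) where

  ternary-cong : ∀ {v w} → v ≈ w → TernaryCoords bs v → TernaryCoords bs w
  ternary-cong v≈w (cs , len , tern , eq) = cs , len , tern , λ i → trans (eq i) (v≈w i)

  ternary-nth : ∀ p → p < length bs → TernaryCoords bs (nth bs p)
  ternary-nth p p<n = applyUpTo (λ t → δ t p) (length bs) , ListP.length-applyUpTo _ (length bs)
    , AllP.applyUpTo⁺₂ _ (length bs) (λ t → δ-ternary t p) , lincomb-δ bs p p<n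

  ternary-neg : ∀ {v} → TernaryCoords bs v → TernaryCoords bs (negE v)
  ternary-neg (cs , len , tern , eq) = map -_ cs , trans (ListP.length-map -_ cs) len
    , AllP.map⁺ (All.map neg-ternary tern) , λ i → trans (lincomb-neg bs cs i) (cong -_ (eq i))

  ternary-zero : ∀ {v} → v ≈ zeroE → TernaryCoords bs v
  ternary-zero v≈0 = applyUpTo (λ _ → 0ℚ) (length bs) , ListP.length-applyUpTo _ (length bs)
    , AllP.applyUpTo⁺₂ _ (length bs) (λ _ → inj₂ (inj₁ refl))
    , λ i → trans (lincomb-zeros bs (length bs) i) (sym (v≈0 i))

  ternary-sign : ∀ {v} s → TernaryCoords bs v → TernaryCoords bs (λ i → sign s * v i)
  ternary-sign {v} false t = ternary-cong (λ i → sym (ℚP.*-identityˡ (v i))) t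
  ternary-sign {v} true t =
    ternary-cong (λ i → solve 1 (λ x → :- x := (:- con 1ℚ) :* x) refl (v i)) (ternary-neg t)

ternary-reω-imω : ∀ {m} (bs : List (Elem (suc m))) →
  TernaryCoords bs (λ i → δ (toℕ i) 0) →
  (∀ j → suc j < suc m → TernaryCoords bs (λ i → reCoord (suc m) (suc j) (toℕ i))) →
  (∀ j → suc j < suc m → TernaryCoords bs (λ i → imCoord (suc m) (suc j) (toℕ i))) →
  ∀ t → TernaryCoords bs (reω (suc m) t) × TernaryCoords bs (imω (suc m) t)
ternary-reω-imω {m} bs e₀ re im t = reω-ternary t , imω-ternary t
  where
  M = suc m

  reUnit-ternary : ∀ p → InRange M p → TernaryCoords bs (reUnit M p)
  reUnit-ternary (s , zero) _ =
    ternary-cong bs (λ i → sym (reUnit-zero M s i)) (ternary-sign bs s e₀)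
  reUnit-ternary (s , suc j) 1+j<M =
    ternary-cong bs (λ i → sym (reUnit-suc M s j i)) (ternary-sign bs s (re j 1+j<M))

  imUnit-ternary : ∀ p → InRange M p → TernaryCoords bs (imUnit M p)
  imUnit-ternary (s , zero) _ = ternary-zero bs (imUnit-zero M s)
  imUnit-ternary (s , suc j) 1+j<M =
    ternary-cong bs (λ i → sym (imUnit-suc M s j i)) (ternary-sign bs s (im j 1+j<M))

  reω-ternary : ∀ t → TernaryCoords bs (reω M t)
  reω-ternary (+ u) = ternary-cong bs (λ i → sym (reω-+ m u i))
    (reUnit-ternary (powIndex M u) (powIndex-inRange M u z<s))
  reω-ternary -[1+ u ] = ternary-cong bs (λ i → sym (reω-− m u i))
    (reUnit-ternary (powIndex M (suc u)) (powIndex-inRange M (suc u) z<s))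

  imω-ternary : ∀ t → TernaryCoords bs (imω M t)
  imω-ternary (+ u) = ternary-cong bs (λ i → sym (imω-+ m u i))
    (imUnit-ternary (powIndex M u) (powIndex-inRange M u z<s))
  imω-ternary -[1+ u ] = ternary-cong bs (λ i → sym (imω-− m u i))
    (ternary-neg bs (imUnit-ternary (powIndex M (suc u)) (powIndex-inRange M (suc u) z<s)))

-- The basis A ∪ B

Σ< : ℕ → (ℕ → ℚ) → ℚ
Σ< zero g = 0ℚ
Σ< (suc n) g = g 0 + Σ< n (g ∘ suc)

Σ<-cong : ∀ n {f g} → (∀ t → t < n → f t ≡ g t) → Σ< n f ≡ Σ< n g
Σ<-cong zero e = refl
Σ<-cong (suc n) e = cong₂ _+_ (e 0 z<s) (Σ<-cong n (λ t t<n → e (suc t) (s<s t<n)))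

Σ<-+ : ∀ n f g → Σ< n (λ t → f t + g t) ≡ Σ< n f + Σ< n g
Σ<-+ zero f g = refl
Σ<-+ (suc n) f g rewrite Σ<-+ n (f ∘ suc) (g ∘ suc) =
  solve 4 (λ a b c d → a :+ b :+ (c :+ d) := a :+ c :+ (b :+ d)) refl
    (f 0) (g 0) (Σ< n (f ∘ suc)) (Σ< n (g ∘ suc))

Σ<-* : ∀ n c f → Σ< n (λ t → c * f t) ≡ c * Σ< n f
Σ<-* zero c f = sym (ℚP.*-zeroʳ c)
Σ<-* (suc n) c f rewrite Σ<-* n c (f ∘ suc) = sym (ℚP.*-distribˡ-+ c (f 0) (Σ< n (f ∘ suc)))

Σ<-zero : ∀ n g → (∀ t → t < n → g t ≡ 0ℚ) → Σ< n g ≡ 0ℚ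
Σ<-zero zero g e = refl
Σ<-zero (suc n) g e rewrite e 0 z<s | Σ<-zero n (g ∘ suc) (λ t t<n → e (suc t) (s<s t<n)) = refl

Σ<-linear : ∀ n p q f g → Σ< n (λ t → p * f t + q * g t) ≡ p * Σ< n f + q * Σ< n g
Σ<-linear n p q f g =
  trans (Σ<-+ n (λ t → p * f t) (λ t → q * g t)) (cong₂ _+_ (Σ<-* n p f) (Σ<-* n q g))

Σ<-δ : ∀ n (x : ℕ → ℚ) q → q < n → Σ< n (λ t → x t * δ q t) ≡ x q
Σ<-δ (suc n) x zero _
  rewrite Σ<-zero n (λ t → x (suc t) * δ 0 (suc t)) (λ t _ → ℚP.*-zeroʳ (x (suc t))) =
  trans (ℚP.+-identityʳ (x 0 * 1ℚ)) (ℚP.*-identityʳ (x 0))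
Σ<-δ (suc n) x (suc q) (s≤s q<n) rewrite Σ<-δ n (x ∘ suc) q q<n | ℚP.*-zeroʳ (x 0) =
  ℚP.+-identityˡ (x (suc q))

Σ<-δ-out : ∀ n (x : ℕ → ℚ) q → n ≤ q → Σ< n (λ t → x t * δ q t) ≡ 0ℚ
Σ<-δ-out n x q n≤q = Σ<-zero n (λ t → x t * δ q t) λ t t<n →
  trans (cong (x t *_) (δ-≢ q t (λ q≡t → ℕP.<-irrefl (sym q≡t) (ℕP.<-≤-trans t<n n≤q))))
        (ℚP.*-zeroʳ (x t))

Σ<-δ-suc-out : ∀ N (x : ℕ → ℚ) n → n ≡ 0 ⊎ N < n → Σ< N (λ t → x t * δ n (suc t)) ≡ 0ℚ
Σ<-δ-suc-out N x .0 (inj₁ refl) = Σ<-zero N (λ t → x t * δ 0 (suc t)) (λ t _ → ℚP.*-zeroʳ (x t))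
Σ<-δ-suc-out N x (suc n) (inj₂ (s≤s N≤n)) = Σ<-δ-out N x n N≤n

m∸[1+m∸[1+n]]≡n : ∀ m n → n < m → m ∸ suc (m ∸ suc n) ≡ n
m∸[1+m∸[1+n]]≡n m n n<m rewrite 1+[m∸1+j]≡m∸j m n n<m = ℕP.m∸[m∸n]≡n (ℕP.<⇒≤ n<m)

δ-mirror : ∀ m n t → n < m → t < m → δ n (m ∸ suc t) ≡ δ (m ∸ suc n) t
δ-mirror m n t n<m t<m with n ℕ.≟ m ∸ suc t
... | yes n≡ = trans (δ-≡ _ _ n≡)
  (sym (δ-≡ _ _ (trans (cong (λ z → m ∸ suc z) n≡) (m∸[1+m∸[1+n]]≡n m t t<m))))
... | no n≢ = trans (δ-≢ _ _ n≢)
  (sym (δ-≢ _ _ (λ e → n≢ (trans (sym (m∸[1+m∸[1+n]]≡n m n n<m)) (cong (λ z → m ∸ suc z) e)))))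

Σ<-δ-mirror : ∀ m N (x : ℕ → ℚ) n → N ≤ m → n < m →
  Σ< N (λ t → x t * δ n (m ∸ suc t)) ≡ Σ< N (λ t → x t * δ (m ∸ suc n) t)
Σ<-δ-mirror m N x n N≤m n<m =
  Σ<-cong N (λ t t<N → cong (x t *_) (δ-mirror m n t n<m (ℕP.<-≤-trans t<N N≤m)))

lincomb-applyUpTo : ∀ {m} (F : ℕ → Elem m) (a : ℕ → ℚ) n i →
  lincomb (applyUpTo F n) (applyUpTo a n) i ≡ Σ< n (λ t → a t * F t i)
lincomb-applyUpTo F a zero i = refl
lincomb-applyUpTo F a (suc n) i = cong (_+_ (a 0 * F 0 i)) (lincomb-applyUpTo (F ∘ suc) (a ∘ suc) n i)

lincomb-++ : ∀ {m} (xs ys : List (Elem m)) cs ds → length cs ≡ length xs → ∀ i →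
  lincomb (xs ++ ys) (cs ++ ds) i ≡ lincomb xs cs i + lincomb ys ds i
lincomb-++ [] ys [] ds _ i = sym (ℚP.+-identityˡ (lincomb ys ds i))
lincomb-++ (x ∷ xs) ys (c ∷ cs) ds e i rewrite lincomb-++ xs ys cs ds (ℕP.suc-injective e) i =
  sym (ℚP.+-assoc (c * x i) (lincomb xs cs i) (lincomb ys ds i))

coeff : List ℚ → ℕ → ℚ
coeff [] _ = 0ℚ
coeff (c ∷ cs) zero = c
coeff (c ∷ cs) (suc t) = coeff cs t

≡applyUpTo-coeff : ∀ cs → cs ≡ applyUpTo (coeff cs) (length cs)
≡applyUpTo-coeff [] = refl
≡applyUpTo-coeff (c ∷ cs) = cong (c ∷_) (≡applyUpTo-coeff cs)

applyUpTo-+ : ∀ {A : Set} (f : ℕ → A) a b →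
  applyUpTo f (a ℕ.+ b) ≡ applyUpTo f a ++ applyUpTo (λ t → f (a ℕ.+ t)) b
applyUpTo-+ f zero b = refl
applyUpTo-+ f (suc a) b = cong (f 0 ∷_) (applyUpTo-+ (f ∘ suc) a b)

nth-++ˡ : ∀ {m} (xs ys : List (Elem m)) p → p < length xs → nth (xs ++ ys) p ≡ nth xs p
nth-++ˡ (x ∷ xs) ys zero _ = refl
nth-++ˡ (x ∷ xs) ys (suc p) (s≤s p<n) = nth-++ˡ xs ys p p<n

nth-++ʳ : ∀ {m} (xs ys : List (Elem m)) q → nth (xs ++ ys) (length xs ℕ.+ q) ≡ nth ys q
nth-++ʳ [] ys q = refl
nth-++ʳ (x ∷ xs) ys q = nth-++ʳ xs ys q

nth-applyUpTo : ∀ {m} (f : ℕ → Elem m) n p → p < n → nth (applyUpTo f n) p ≡ f p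
nth-applyUpTo f (suc n) zero _ = refl
nth-applyUpTo f (suc n) (suc p) (s≤s p<n) = nth-applyUpTo (f ∘ suc) n p p<n

½[x-y]+½[x+y]≡x : ∀ x y → ½ * (x - y) + ½ * (x + y) ≡ x
½[x-y]+½[x+y]≡x x y = trans
  (solve 3 (λ h x y → h :* (x :- y) :+ h :* (x :+ y) := (h :+ h) :* x) refl ½ x y) (ℚP.*-identityˡ x)

-½[x-y]+½[x+y]≡y : ∀ x y → (- ½) * (x - y) + ½ * (x + y) ≡ y
-½[x-y]+½[x+y]≡y x y = trans
  (solve 3 (λ h x y → (:- h) :* (x :- y) :+ h :* (x :+ y) := (h :+ h) :* y) refl ½ x y) (ℚP.*-identityˡ y)

[½x+½y]-[-½x+½y]≡x : ∀ x y → (½ * x + ½ * y) - ((- ½) * x + ½ * y) ≡ x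
[½x+½y]-[-½x+½y]≡x x y = trans
  (solve 3 (λ h x y → (h :* x :+ h :* y) :- ((:- h) :* x :+ h :* y) := (h :+ h) :* x) refl ½ x y)
  (ℚP.*-identityˡ x)

[½x+½y]+[-½x+½y]≡y : ∀ x y → (½ * x + ½ * y) + ((- ½) * x + ½ * y) ≡ y
[½x+½y]+[-½x+½y]≡y x y = trans
  (solve 3 (λ h x y → (h :* x :+ h :* y) :+ ((:- h) :* x :+ h :* y) := (h :+ h) :* y) refl ½ x y)
  (ℚP.*-identityˡ y)

halfBasis : (m H : ℕ) → List (Elem m)
halfBasis m H = applyUpTo (λ t → reω m (+ t)) H ++ applyUpTo (λ t → imω m (+ suc t)) H

module HalfBasis (h' : ℕ) where

  h : ℕ
  h = suc h'

  m : ℕ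
  m = h ℕ.+ h

  reBasis : ℕ → Elem m
  reBasis t = reω m (+ t)

  imBasis : ℕ → Elem m
  imBasis t = imω m (+ suc t)

  As : List (Elem m)
  As = applyUpTo reBasis h

  basis : List (Elem m)
  basis = halfBasis m h

  h≤m : h ≤ m
  h≤m = ℕP.m≤m+n h h

  h<m : h < m
  h<m = ℕP.m<m+n h z<s

  length-As : length As ≡ h
  length-As = ListP.length-applyUpTo reBasis h

  length-basis : length basis ≡ m
  length-basis = trans (ListP.length-++ As) (cong₂ ℕ._+_ length-As (ListP.length-applyUpTo imBasis h))

  nth-basis-re : ∀ p → p < h → nth basis p ≡ reBasis p
  nth-basis-re p p<h =
    trans (nth-++ˡ As _ p (subst (p <_) (sym length-As) p<h)) (nth-applyUpTo reBasis h p p<h)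

  nth-basis-im : ∀ q → q < h → nth basis (h ℕ.+ q) ≡ imBasis q
  nth-basis-im q q<h = trans (cong (λ l → nth basis (l ℕ.+ q)) (sym length-As))
    (trans (nth-++ʳ As _ q) (nth-applyUpTo imBasis h q q<h))

  reBasis-0≈e₀ : reBasis 0 ≈ (λ i → δ (toℕ i) 0)
  reBasis-0≈e₀ i = trans (reω-+ (h' ℕ.+ h) 0 i) (trans (reUnit-zero m false i) (ℚP.*-identityˡ _))

  reBasis-suc≈reCoord : ∀ t → suc t < m → reBasis (suc t) ≈ (λ i → reCoord m (suc t) (toℕ i))
  reBasis-suc≈reCoord t 1+t<m i = trans (reω-+ (h' ℕ.+ h) (suc t) i)
    (trans (cong (λ p → reUnit m p i) (powIndex-< m (suc t) 1+t<m))
    (trans (reUnit-suc m false t i) (ℚP.*-identityˡ _)))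

  imBasis≈imCoord : ∀ t → suc t < m → imBasis t ≈ (λ i → imCoord m (suc t) (toℕ i))
  imBasis≈imCoord t 1+t<m i = trans (imω-+ (h' ℕ.+ h) (suc t) i)
    (trans (cong (λ p → imUnit m p i) (powIndex-< m (suc t) 1+t<m))
    (trans (imUnit-suc m false t i) (ℚP.*-identityˡ _)))

  e₀-ternary : TernaryCoords basis (λ i → δ (toℕ i) 0)
  e₀-ternary = ternary-cong basis
    (λ i → trans (cong (λ v → v i) (nth-basis-re 0 z<s)) (reBasis-0≈e₀ i))
    (ternary-nth basis 0 (subst (0 <_) (sym length-basis) z<s))

  reCoord-ternary-low : ∀ j → 1 ≤ j → j < h → TernaryCoords basis (λ i → reCoord m j (toℕ i))
  reCoord-ternary-low (suc j) _ 1+j<h = ternary-cong basis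
    (λ i → trans (cong (λ v → v i) (nth-basis-re (suc j) 1+j<h)) (reBasis-suc≈reCoord j 1+j<m i))
    (ternary-nth basis (suc j) (subst (suc j <_) (sym length-basis) 1+j<m))
    where
    1+j<m : suc j < m
    1+j<m = ℕP.<-≤-trans 1+j<h h≤m

  imCoord-ternary-low : ∀ j → 1 ≤ j → j ≤ h → TernaryCoords basis (λ i → imCoord m j (toℕ i))
  imCoord-ternary-low (suc q) _ (s≤s q<h) = ternary-cong basis
    (λ i → trans (cong (λ v → v i) (nth-basis-im q (s≤s q<h))) (imBasis≈imCoord q 1+q<m i))
    (ternary-nth basis (h ℕ.+ q) (subst (h ℕ.+ q <_) (sym length-basis) (ℕP.+-monoʳ-< h (s≤s q<h))))
    where
    1+q<m : suc q < m
    1+q<m = ℕP.≤-<-trans (s≤s q<h) h<m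

  m∸j<h : ∀ j → h < j → j < m → m ∸ j < h
  m∸j<h j h<j j<m = subst (m ∸ j <_) (ℕP.m+n∸n≡m h h) (ℕP.∸-monoʳ-< h<j (ℕP.<⇒≤ j<m))

  reCoord-ternary : ∀ j → 1 ≤ j → j < m → TernaryCoords basis (λ i → reCoord m j (toℕ i))
  reCoord-ternary j 1≤j j<m with ℕP.<-cmp j h
  ... | tri< j<h _ _ = reCoord-ternary-low j 1≤j j<h
  ... | tri≈ _ refl _ = ternary-zero basis (λ i → reCoord-half h (toℕ i))
  ... | tri> _ _ h<j = ternary-cong basis (λ i → sym (reCoord-mirror m j (toℕ i) (ℕP.<⇒≤ j<m)))
    (ternary-neg basis (reCoord-ternary-low (m ∸ j) (ℕP.m<n⇒0<n∸m j<m) (m∸j<h j h<j j<m)))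

  imCoord-ternary : ∀ j → 1 ≤ j → j < m → TernaryCoords basis (λ i → imCoord m j (toℕ i))
  imCoord-ternary j 1≤j j<m with ℕP.≤-<-connex j h
  ... | inj₁ j≤h = imCoord-ternary-low j 1≤j j≤h
  ... | inj₂ h<j = ternary-cong basis (λ i → sym (imCoord-mirror m j (toℕ i) (ℕP.<⇒≤ j<m)))
    (imCoord-ternary-low (m ∸ j) (ℕP.m<n⇒0<n∸m j<m) (ℕP.<⇒≤ (m∸j<h j h<j j<m)))

  ternary : ∀ t → TernaryCoords basis (reω m t) × TernaryCoords basis (imω m t)
  ternary = ternary-reω-imω basis e₀-ternary
    (λ j → reCoord-ternary (suc j) (s≤s z≤n)) (λ j → imCoord-ternary (suc j) (s≤s z≤n))

  reLow reHigh imLow imHigh : (ℕ → ℚ) → ℕ → ℚ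
  reLow a n = Σ< h' (λ t → a (suc t) * δ n (suc t))
  reHigh a n = Σ< h' (λ t → a (suc t) * δ n (m ∸ suc t))
  imLow b n = Σ< h (λ t → b t * δ n (suc t))
  imHigh b n = Σ< h (λ t → b t * δ n (m ∸ suc t))

  coord : (ℕ → ℚ) → (ℕ → ℚ) → ℕ → ℚ
  coord a b n = a 0 * δ n 0 + (½ * reLow a n + (- ½) * reHigh a n) + (½ * imLow b n + ½ * imHigh b n)

  coord-≡ : ∀ a b n {d x y z w} →
    δ n 0 ≡ d → reLow a n ≡ x → reHigh a n ≡ y → imLow b n ≡ z → imHigh b n ≡ w →
    coord a b n ≡ a 0 * d + (½ * x + (- ½) * y) + (½ * z + ½ * w)
  coord-≡ a b n refl refl refl refl refl = refl

  lincomb-basis : ∀ (a b : ℕ → ℚ) i →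
    lincomb basis (applyUpTo a h ++ applyUpTo b h) i ≡ coord a b (toℕ i)
  lincomb-basis a b i = begin
      lincomb basis (applyUpTo a h ++ applyUpTo b h) i
    ≡⟨ lincomb-++ As _ (applyUpTo a h) _ (trans (ListP.length-applyUpTo a h) (sym length-As)) i ⟩
      lincomb As (applyUpTo a h) i + lincomb (applyUpTo imBasis h) (applyUpTo b h) i
    ≡⟨ cong₂ _+_ (lincomb-applyUpTo reBasis a h i) (lincomb-applyUpTo imBasis b h i) ⟩
      a 0 * reBasis 0 i + Σ< h' (λ t → a (suc t) * reBasis (suc t) i) + Σ< h (λ t → b t * imBasis t i)
    ≡⟨ cong₂ _+_ (cong₂ _+_ (cong (a 0 *_) (reBasis-0≈e₀ i)) reSum) imSum ⟩
      coord a b n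
    ∎
    where
    open ≡-Reasoning
    n = toℕ i
    reSum : Σ< h' (λ t → a (suc t) * reBasis (suc t) i) ≡ ½ * reLow a n + (- ½) * reHigh a n
    reSum = trans (Σ<-cong h' λ t t<h' → trans
                    (cong (a (suc t) *_) (reBasis-suc≈reCoord t (ℕP.<-≤-trans (s<s t<h') h≤m) i))
                    (solve 4 (λ c x d e → x :* (c :* (d :- e)) := c :* (x :* d) :+ (:- c) :* (x :* e))
                      refl ½ (a (suc t)) (δ n (suc t)) (δ n (m ∸ suc t))))
                  (Σ<-linear h' ½ (- ½) (λ t → a (suc t) * δ n (suc t))
                                        (λ t → a (suc t) * δ n (m ∸ suc t)))
    imSum : Σ< h (λ t → b t * imBasis t i) ≡ ½ * imLow b n + ½ * imHigh b n
    imSum = trans (Σ<-cong h λ t t<h → trans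
                    (cong (b t *_) (imBasis≈imCoord t (ℕP.≤-<-trans t<h h<m) i))
                    (solve 4 (λ c x d e → x :* (c :* (d :+ e)) := c :* (x :* d) :+ c :* (x :* e))
                      refl ½ (b t) (δ n (suc t)) (δ n (m ∸ suc t))))
                  (Σ<-linear h ½ ½ (λ t → b t * δ n (suc t)) (λ t → b t * δ n (m ∸ suc t)))

  h≤m∸[1+n] : ∀ n → suc n ≤ h → h ≤ m ∸ suc n
  h≤m∸[1+n] n 1+n≤h = subst (_≤ m ∸ suc n) (ℕP.m+n∸n≡m h h) (ℕP.∸-monoʳ-≤ m 1+n≤h)

  h'≤m : h' ≤ m
  h'≤m = ℕP.≤-trans (ℕP.n≤1+n h') h≤m

  coord-0 : ∀ a b → coord a b 0 ≡ a 0
  coord-0 a b = trans (coord-≡ a b 0 refl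
      (Σ<-δ-suc-out h' (a ∘ suc) 0 (inj₁ refl))
      (trans (Σ<-δ-mirror m h' (a ∘ suc) 0 h'≤m z<s)
             (Σ<-δ-out h' (a ∘ suc) (m ∸ 1)
               (ℕP.≤-trans (ℕP.n≤1+n h') (h≤m∸[1+n] 0 (s≤s z≤n)))))
      (Σ<-δ-suc-out h b 0 (inj₁ refl))
      (trans (Σ<-δ-mirror m h b 0 h≤m z<s) (Σ<-δ-out h b (m ∸ 1) (h≤m∸[1+n] 0 (s≤s z≤n)))))
    (solve 1 (λ x → x :* con 1ℚ :+ (con ½ :* con 0ℚ :+ (:- con ½) :* con 0ℚ)
                      :+ (con ½ :* con 0ℚ :+ con ½ :* con 0ℚ) := x) refl (a 0))

  coord-low : ∀ a b n → n < h' → coord a b (suc n) ≡ ½ * a (suc n) + ½ * b n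
  coord-low a b n n<h' = trans (coord-≡ a b (suc n) refl
      (Σ<-δ h' (a ∘ suc) n n<h')
      (trans (Σ<-δ-mirror m h' (a ∘ suc) (suc n) h'≤m 1+n<m)
             (Σ<-δ-out h' (a ∘ suc) q (ℕP.≤-trans (ℕP.n≤1+n h') h≤q)))
      (Σ<-δ h b n (ℕP.<-trans n<h' (ℕP.n<1+n h')))
      (trans (Σ<-δ-mirror m h b (suc n) h≤m 1+n<m) (Σ<-δ-out h b q h≤q)))
    (solve 3 (λ x y z → x :* con 0ℚ :+ (con ½ :* y :+ (:- con ½) :* con 0ℚ)
                          :+ (con ½ :* z :+ con ½ :* con 0ℚ) := con ½ :* y :+ con ½ :* z)
      refl (a 0) (a (suc n)) (b n))
    where
    q = m ∸ suc (suc n)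
    h≤q : h ≤ q
    h≤q = h≤m∸[1+n] (suc n) (s≤s n<h')
    1+n<m : suc n < m
    1+n<m = ℕP.<-trans (s<s n<h') h<m

  coord-half : ∀ a b → coord a b h ≡ b h'
  coord-half a b = trans (coord-≡ a b h refl
      (Σ<-δ-out h' (a ∘ suc) h' ℕP.≤-refl)
      (trans (Σ<-δ-mirror m h' (a ∘ suc) h h'≤m h<m)
             (Σ<-δ-out h' (a ∘ suc) (m ∸ suc h) (ℕP.≤-reflexive (sym m∸[1+h]≡h'))))
      (Σ<-δ h b h' (ℕP.n<1+n h'))
      (trans (Σ<-δ-mirror m h b h h≤m h<m)
        (trans (cong (λ q → Σ< h (λ t → b t * δ q t)) m∸[1+h]≡h') (Σ<-δ h b h' (ℕP.n<1+n h')))))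
    (solve 2 (λ x z → x :* con 0ℚ :+ (con ½ :* con 0ℚ :+ (:- con ½) :* con 0ℚ)
                        :+ (con ½ :* z :+ con ½ :* z) := z) refl (a 0) (b h'))
    where
    m∸[1+h]≡h' : m ∸ suc h ≡ h'
    m∸[1+h]≡h' = ℕP.m+n∸n≡m h' (suc h')

  coord-high : ∀ a b t → t < h' → coord a b (m ∸ suc t) ≡ (- ½) * a (suc t) + ½ * b t
  coord-high a b t t<h' = trans (coord-≡ a b n
      (δ-≢ n 0 (λ n≡0 → ℕP.<-irrefl (sym n≡0) (ℕP.<-trans z<s h<n)))
      (Σ<-δ-suc-out h' (a ∘ suc) n (inj₂ (ℕP.<-trans (ℕP.n<1+n h') h<n)))
      (trans (Σ<-δ-mirror m h' (a ∘ suc) n h'≤m n<m)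
        (trans (cong (λ q → Σ< h' (λ s → a (suc s) * δ q s)) (m∸[1+m∸[1+n]]≡n m t t<m))
               (Σ<-δ h' (a ∘ suc) t t<h')))
      (Σ<-δ-suc-out h b n (inj₂ h<n))
      (trans (Σ<-δ-mirror m h b n h≤m n<m)
        (trans (cong (λ q → Σ< h (λ s → b s * δ q s)) (m∸[1+m∸[1+n]]≡n m t t<m))
               (Σ<-δ h b t (ℕP.<-trans t<h' (ℕP.n<1+n h'))))))
    (solve 3 (λ x y z → x :* con 0ℚ :+ (con ½ :* con 0ℚ :+ (:- con ½) :* y)
                          :+ (con ½ :* con 0ℚ :+ con ½ :* z) := (:- con ½) :* y :+ con ½ :* z)
      refl (a 0) (a (suc t)) (b t))
    where
    n = m ∸ suc t
    t<m : t < m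
    t<m = ℕP.<-trans (ℕP.<-trans t<h' (ℕP.n<1+n h')) h<m
    n<m : n < m
    n<m = m∸1+j<m m t z<s
    h<n : h < n
    h<n = subst (_< n) (ℕP.m+n∸n≡m h h) (ℕP.∸-monoʳ-< (s<s t<h') h≤m)

  extend : Elem m → ℕ → ℚ
  extend v n with n ℕ.<? m
  ... | yes n<m = v (fromℕ< n<m)
  ... | no _ = 0ℚ

  extend-toℕ : ∀ v i → extend v (toℕ i) ≡ v i
  extend-toℕ v i with toℕ i ℕ.<? m
  ... | yes i<m = cong v (FinP.fromℕ<-toℕ i i<m)
  ... | no i≮m = contradiction (FinP.toℕ<n i) i≮m

  reCoeff : Elem m → ℕ → ℚ
  reCoeff v zero = extend v 0
  reCoeff v (suc t) = extend v (suc t) - extend v (m ∸ suc t)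

  imCoeff : Elem m → ℕ → ℚ
  imCoeff v t = if does (t ℕ.≟ h') then extend v h else extend v (suc t) + extend v (m ∸ suc t)

  imCoeff-≢ : ∀ v t → t ≢ h' → imCoeff v t ≡ extend v (suc t) + extend v (m ∸ suc t)
  imCoeff-≢ v t t≢h' rewrite dec-false (t ℕ.≟ h') t≢h' = refl

  imCoeff-h' : ∀ v → imCoeff v h' ≡ extend v h
  imCoeff-h' v rewrite dec-true (h' ℕ.≟ h') refl = refl

  coord-coeff : ∀ v n → n < m → coord (reCoeff v) (imCoeff v) n ≡ extend v n
  coord-coeff v zero _ = coord-0 (reCoeff v) (imCoeff v)
  coord-coeff v (suc n) 1+n<m with ℕP.<-cmp n h'
  ... | tri< n<h' _ _ = trans (coord-low (reCoeff v) (imCoeff v) n n<h')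
    (trans (cong (λ z → ½ * reCoeff v (suc n) + ½ * z) (imCoeff-≢ v n (ℕP.<⇒≢ n<h')))
           (½[x-y]+½[x+y]≡x (extend v (suc n)) (extend v (m ∸ suc n))))
  ... | tri≈ _ refl _ = trans (coord-half (reCoeff v) (imCoeff v)) (imCoeff-h' v)
  ... | tri> _ _ h'<n = subst (λ z → coord (reCoeff v) (imCoeff v) z ≡ extend v z)
          (m∸[1+m∸[1+n]]≡n m (suc n) 1+n<m) (high (m ∸ suc (suc n)) t<h')
    where
    t<h' : m ∸ suc (suc n) < h'
    t<h' = subst (m ∸ suc (suc n) <_) (ℕP.m+n∸n≡m h' (suc h')) (ℕP.∸-monoʳ-< (s<s (s<s h'<n)) 1+n<m)
    high : ∀ t → t < h' → coord (reCoeff v) (imCoeff v) (m ∸ suc t) ≡ extend v (m ∸ suc t)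
    high t t<h' = trans (coord-high (reCoeff v) (imCoeff v) t t<h')
      (trans (cong (λ z → (- ½) * reCoeff v (suc t) + ½ * z) (imCoeff-≢ v t (ℕP.<⇒≢ t<h')))
             (-½[x-y]+½[x+y]≡y (extend v (suc t)) (extend v (m ∸ suc t))))

  spans : Spans basis
  spans v = applyUpTo (reCoeff v) h ++ applyUpTo (imCoeff v) h
    , trans (ListP.length-++ (applyUpTo (reCoeff v) h))
        (trans (cong₂ ℕ._+_ (ListP.length-applyUpTo (reCoeff v) h) (ListP.length-applyUpTo (imCoeff v) h))
               (sym length-basis))
    , λ i → trans (lincomb-basis (reCoeff v) (imCoeff v) i)
              (trans (coord-coeff v (toℕ i) (FinP.toℕ<n i)) (extend-toℕ v i))

  linIndep : LinIndep basis
  linIndep cs len-cs lc≈0 =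
    subst (All (_≡ 0ℚ)) (sym cs≡)
      (AllP.++⁺ (AllP.applyUpTo⁺₁ a h a≡0) (AllP.applyUpTo⁺₁ b h b≡0))
    where
    a b : ℕ → ℚ
    a = coeff cs
    b t = coeff cs (h ℕ.+ t)
    cs≡ : cs ≡ applyUpTo a h ++ applyUpTo b h
    cs≡ = trans (≡applyUpTo-coeff cs)
      (trans (cong (applyUpTo a) (trans len-cs length-basis)) (applyUpTo-+ a h h))
    coord≡0 : ∀ n → n < m → coord a b n ≡ 0ℚ
    coord≡0 n n<m = trans
      (sym (trans (lincomb-basis a b (fromℕ< n<m)) (cong (coord a b) (FinP.toℕ-fromℕ< n<m))))
      (subst (λ c → lincomb basis c ≈ zeroE) cs≡ lc≈0 (fromℕ< n<m))
    sum≡0 : ∀ t → t < h' → ½ * a (suc t) + ½ * b t ≡ 0ℚ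
    sum≡0 t t<h' = trans (sym (coord-low a b t t<h')) (coord≡0 (suc t) (ℕP.<-trans (s<s t<h') h<m))
    diff≡0 : ∀ t → t < h' → (- ½) * a (suc t) + ½ * b t ≡ 0ℚ
    diff≡0 t t<h' = trans (sym (coord-high a b t t<h')) (coord≡0 (m ∸ suc t) (m∸1+j<m m t z<s))
    a≡0 : ∀ {t} → t < h → a t ≡ 0ℚ
    a≡0 {zero} _ = trans (sym (coord-0 a b)) (coord≡0 0 z<s)
    a≡0 {suc t} (s≤s t<h') = trans (sym ([½x+½y]-[-½x+½y]≡x (a (suc t)) (b t)))
      (cong₂ _-_ (sum≡0 t t<h') (diff≡0 t t<h'))
    b≡0 : ∀ {t} → t < h → b t ≡ 0ℚ
    b≡0 {t} (s≤s t≤h') with ℕP.m≤n⇒m<n∨m≡n t≤h'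
    ... | inj₁ t<h' = trans (sym ([½x+½y]+[-½x+½y]≡y (a (suc t)) (b t)))
      (cong₂ _+_ (sum≡0 t t<h') (diff≡0 t t<h'))
    ... | inj₂ refl = trans (sym (coord-half a b)) (coord≡0 h h<m)

  isBasis : IsBasis basis
  isBasis = linIndep , spans

halfBasis-basis-ternary : ∀ m H → 0 < H → m ≡ H ℕ.+ H →
  IsBasis (halfBasis m H) ×
  ((t : ℤ) → TernaryCoords (halfBasis m H) (reω m t) × TernaryCoords (halfBasis m H) (imω m t))
halfBasis-basis-ternary _ (suc h') _ refl = HalfBasis.isBasis h' , HalfBasis.ternary h'

-- The index sets

filter-applyUpTo-prefix : ∀ {A : Set} {P : Pred A 0ℓ} (P? : Decidable P) (f : ℕ → A) a b →
  (∀ {i} → i < a → P (f i)) → (∀ t → ¬ P (f (a ℕ.+ t))) →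
  filter P? (applyUpTo f (a ℕ.+ b)) ≡ applyUpTo f a
filter-applyUpTo-prefix P? f a b below above = begin
    filter P? (applyUpTo f (a ℕ.+ b))
  ≡⟨ cong (filter P?) (applyUpTo-+ f a b) ⟩
    filter P? (applyUpTo f a ++ applyUpTo (λ t → f (a ℕ.+ t)) b)
  ≡⟨ ListP.filter-++ P? (applyUpTo f a) _ ⟩
    filter P? (applyUpTo f a) ++ filter P? (applyUpTo (λ t → f (a ℕ.+ t)) b)
  ≡⟨ cong₂ _++_ (ListP.filter-all P? (AllP.applyUpTo⁺₁ f a below))
                (ListP.filter-none P? (AllP.applyUpTo⁺₂ _ b above)) ⟩
    applyUpTo f a ++ []
  ≡⟨ ListP.++-identityʳ (applyUpTo f a) ⟩
    applyUpTo f a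
  ∎
  where open ≡-Reasoning

AB≡halfBasis : ∀ k → AB (suc (suc k)) ≡ halfBasis (deg (suc (suc k))) (2 ^ k)
AB≡halfBasis k = cong₂ _++_
  (trans (cong (map (Reω K ∘ +_)) indicesA≡) (ListP.map-upTo (Reω K ∘ +_) H))
  (trans (cong (map (iImω K ∘ +_)) indicesB≡) (ListP.map-applyUpTo suc (iImω K ∘ +_) H))
  where
  K = suc (suc k)
  H = 2 ^ k
  2^K≡4H : 2 ^ K ≡ 4 ℕ.* H
  2^K≡4H = sym (ℕP.*-assoc 2 2 H)
  indicesA≡ : indicesA K ≡ upTo H
  indicesA≡ = trans (cong (λ N → filter (λ t → 4 ℕ.* t ℕ.<? 2 ^ K) (upTo N)) 2^K≡4H)
    (filter-applyUpTo-prefix (λ t → 4 ℕ.* t ℕ.<? 2 ^ K) (λ t → t) H (3 ℕ.* H)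
      (λ {i} i<H → subst (4 ℕ.* i <_) (sym 2^K≡4H) (ℕP.*-monoʳ-< 4 i<H))
      (λ t → ℕP.≤⇒≯ (subst (_≤ 4 ℕ.* (H ℕ.+ t)) (sym 2^K≡4H)
                            (ℕP.*-monoʳ-≤ 4 (ℕP.m≤m+n H t)))))
  indicesB≡ : indicesB K ≡ applyUpTo suc H
  indicesB≡ = trans (cong (λ N → filter PB? (applyUpTo suc N)) 2^K≡4H)
    (filter-applyUpTo-prefix PB? suc H (3 ℕ.* H)
      (λ {i} i<H → s≤s z≤n , subst (4 ℕ.* suc i ≤_) (sym 2^K≡4H) (ℕP.*-monoʳ-≤ 4 i<H))
      (λ t → ℕP.<⇒≱ (subst (_< 4 ℕ.* suc (H ℕ.+ t)) (sym 2^K≡4H)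
                            (ℕP.*-monoʳ-< 4 (s≤s (ℕP.m≤m+n H t)))) ∘ proj₂))
    where
    PB? = λ t → (1 ℕ.≤? t) ×-dec (4 ℕ.* t ℕ.≤? 2 ^ K)

AB1-basis : IsBasis (AB 1)
AB1-basis = linIndep , spans
  where
  x*1+0≡x : ∀ x → x * 1ℚ + 0ℚ ≡ x
  x*1+0≡x x = trans (ℚP.+-identityʳ (x * 1ℚ)) (ℚP.*-identityʳ x)
  linIndep : LinIndep (AB 1)
  linIndep (c ∷ []) _ c·1≈0 = trans (sym (x*1+0≡x c)) (c·1≈0 zero) ∷ []
  spans : Spans (AB 1)
  spans v = v zero ∷ [] , refl , λ { zero → x*1+0≡x (v zero) }

AB1-ternary : ∀ t → TernaryCoords (AB 1) (Reω 1 t) × TernaryCoords (AB 1) (iImω 1 t)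
AB1-ternary = ternary-reω-imω (AB 1)
  (ternary-cong (AB 1) (λ { zero → refl }) (ternary-nth (AB 1) 0 z<s))
  (λ _ → λ { (s≤s ()) }) (λ _ → λ { (s≤s ()) })

lemma6 : (k : ℕ) → 1 ≤ k →
    IsBasis (AB k) ×
    ((t : ℤ) → TernaryCoords (AB k) (Reω k t) × TernaryCoords (AB k) (iImω k t))
lemma6 (suc zero) _ = AB1-basis , AB1-ternary
lemma6 (suc (suc k)) _ rewrite AB≡halfBasis k =
  halfBasis-basis-ternary (deg (suc (suc k))) (2 ^ k) (ℕP.m^n>0 2 k)
    (cong (2 ^ k ℕ.+_) (ℕP.+-identityʳ (2 ^ k)))
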